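{- Let $(A,+)$, $(B,+)$ be finite abelian groups with $n=|A|$, and let $f:A\to B$ be an $(n,m,\lambda)$ zero-difference balanced function with $f(A)=\{b_0,\ldots,b_{m-1}\}$. Let $D_i=\{x\in A\mid f(x)=b_i\}$ and $w_i=|D_i|$, and consider $\mathcal{D}=\{D_0,\ldots,D_{m-1}\}$ as an $(n,[w_0,\ldots,w_{m-1}],n-\lambda)$ difference system of sets. Then $\mathcal{D}$ is optimal if and only if $n\ge m\lambda-m+2$.
   Context: $f$ is an $(n,m,\lambda)$ zero-difference balanced function if $m=|f(A)|$ and $|\{x\in A\mid f(x+\alpha)=f(x)\}|=\lambda$ for all $\alpha\in A\setminus\{0\}$. Disjoint subsets $D_0,\ldots,D_{q-1}$ of an abelian group $G$ of order $n$ with $|D_i|=w_i$ form an $(n,[w_0,\ldots,w_{q-1}],\rho)$ difference system of sets (DSS) if the multiset $\{x-y\mid x\in D_i,\ y\in D_j,\ 0\le i\neq j\le q-1\}$ contains every nonzero element of $G$ at least $\rho$ times. Let $\tau=\sum_{i}|D_i|$. For $q\ge 2$ one has $\tau\ge\sqrt{\mathrm{SQUARE}(\rho(n-1)+\lceil\frac{\rho(n-1)}{q-1}\rceil)}$, where $\mathrm{SQUARE}(x)$ is the smallest perfect square not less than $x$; the DSS is optimal if equality holds. -}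

module Defs where

open import Data.Nat using (ℕ; zero; suc; _+_; _*_; _∸_; _≤_)
open import Data.Nat.DivMod using (_/_)
open import Data.Fin using (Fin)
open import Data.Fin.Properties using (any?) renaming (_≟_ to _≟F_)
open import Data.List using (List; length; filter; map)
open import Data.Nat.ListAction using (sum)
open import Data.List.Base using (allFin)
open import Data.Product using (Σ; _×_; ∃)
open import Relation.Binary.PropositionalEquality using (_≡_)
open import Relation.Nullary using (¬_)
open import Algebra.Structures using (IsAbelianGroup)

-- A finite abelian group of order n, represented (up to isomorphism)
-- as an abelian group structure on Fin n with propositional equality.
record FinAbGroup (n : ℕ) : Set where
  field
    _⊕_ : Fin n → Fin n → Fin n
    𝟘   : Fin n
    ⊝_  : Fin n → Fin n
    isAbelianGroup : IsAbelianGroup _≡_ _⊕_ 𝟘 ⊝_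

image : {n k : ℕ} → (Fin n → Fin k) → List (Fin k)
image {n} {k} f = filter (λ b → any? (λ x → f x ≟F b)) (allFin k)

imageSize : {n k : ℕ} → (Fin n → Fin k) → ℕ
imageSize f = length (image f)

zeroDiffCount : {n k : ℕ} → FinAbGroup n → (Fin n → Fin k) → Fin n → ℕ
zeroDiffCount {n} G f α =
  length (filter (λ x → f (x ⊕ α) ≟F f x) (allFin n))
  where open FinAbGroup G

IsZDB : {n k : ℕ} → FinAbGroup n → (Fin n → Fin k) → ℕ → ℕ → Set
IsZDB {n} G f m lam =
  (m ≡ imageSize f) × (∀ α → ¬ (α ≡ 𝟘) → zeroDiffCount G f α ≡ lam)
  where open FinAbGroup G

blockSize : {n k : ℕ} → (Fin n → Fin k) → Fin k → ℕ
blockSize {n} f b = length (filter (λ x → f x ≟F b) (allFin n))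

tau : {n k : ℕ} → (Fin n → Fin k) → ℕ
tau f = sum (map (blockSize f) (image f))

-- ⌈a / d⌉ for d ≥ 1 (junk value 0 for d = 0; only used with d ≥ 1)
ceilDiv : ℕ → ℕ → ℕ
ceilDiv a zero = 0
ceilDiv a (suc d) = (a + d) / suc d

IsSQUARE : ℕ → ℕ → Set
IsSQUARE x s = (∃ λ r → s ≡ r * r) × (x ≤ s) × (∀ r → x ≤ r * r → s ≤ r * r)

-- An (n, [w_0..w_{q-1}], ρ) DSS with τ = Σ w_i (q ≥ 2) is optimal iff
-- τ = sqrt(SQUARE(ρ(n-1) + ⌈ρ(n-1)/(q-1)⌉)), i.e. τ² = SQUARE(...)
OptimalDSS : (n q ρ τ : ℕ) → Set
OptimalDSS n q ρ τ =
  IsSQUARE (ρ * (n ∸ 1) + ceilDiv (ρ * (n ∸ 1)) (q ∸ 1)) (τ * τ)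

-- The fibres D_b of f partition A, so τ = Σ w_b = n, and counting the pairs (x, y) with
-- f x = f y once by fibre and once by the difference α = y − x gives Σ w_b² = n + (n − 1)λ.
-- With ρ = n − λ this says ρ(n − 1) = n² − Σ w_b², and Cauchy–Schwarz, n² ≤ m Σ w_b², then
-- gives ρ(n − 1) + ⌈ρ(n − 1)/(m − 1)⌉ ≤ n².  So the SQUARE of that quantity is n² exactly
-- when it exceeds (n − 1)², which unfolds to n ≥ mλ − m + 2.
module Submission where

open import Defs
open import Data.Nat using (ℕ; zero; suc; _+_; _*_; _∸_; _≤_; _<_; z≤n; s≤s; NonZero; >-nonZero⁻¹)
open import Data.Nat.Properties
open import Data.Nat.DivMod using (_/_; m/n*n≤m; m*n/n≡m; /-monoˡ-≤)
open import Data.Nat.ListAction using (sum)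
open import Data.Nat.Tactic.RingSolver using (solve-∀)
open import Data.Bool using (if_then_else_)
open import Data.Fin using (Fin; zero; suc; punchIn)
open import Data.Fin.Properties using (punchInᵢ≢i) renaming (_≟_ to _≟F_)
open import Data.Fin.Permutation using (Permutation; permutation)
open import Data.List using (List; []; _∷_; length; filter; map; tabulate; allFin)
open import Data.List.Properties using (length-map; map-tabulate; map-∘; filter-none; filter-some; length-filter; length-tabulate)
open import Data.List.Relation.Unary.All as All using (All; []; _∷_)
open import Data.List.Relation.Unary.All.Properties using (all-filter) renaming (tabulate⁺ to All-tabulate⁺)
import Data.List.Relation.Unary.Any.Properties as Any
open import Data.Product using (∃; _,_)
open import Data.Sum using (inj₁; inj₂)
open import Function using (_∘_; id)
open import Function.Bundles using (_⇔_; mk⇔; Equivalence)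
open import Function.Properties.Equivalence using (⇔-setoid) renaming (trans to ⇔-trans)
open import Level using (0ℓ)
open import Relation.Nullary using (Dec; yes; no; does; ¬_; contradiction)
open import Relation.Unary using (Pred; Decidable)
open import Relation.Binary.PropositionalEquality
open import Algebra.Structures using (IsAbelianGroup)
open import Algebra.Properties.Semiring.Sum +-*-semiring
  using (sum-syntax; sum-remove; sum-cong-≗; ∑-comm; ∑-permute; *-distribˡ-sum)
  renaming (sum to ∑)

𝟙 : ∀ {p} {P : Set p} → Dec P → ℕ
𝟙 P? = if does P? then 1 else 0

𝟙-yes : ∀ {p} {P : Set p} (P? : Dec P) → P → 𝟙 P? ≡ 1
𝟙-yes (yes _) _  = refl
𝟙-yes (no ¬p) p = contradiction p ¬p

𝟙-no : ∀ {p} {P : Set p} (P? : Dec P) → ¬ P → 𝟙 P? ≡ 0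
𝟙-no (yes p) ¬p = contradiction p ¬p
𝟙-no (no _)  _  = refl

∑-const : ∀ n v → ∑[ i < n ] v ≡ n * v
∑-const zero    v = refl
∑-const (suc n) v = cong (v +_) (∑-const n v)

∑-constExcept : ∀ {n} (t : Fin n → ℕ) i {v} → (∀ j → j ≢ i → t j ≡ v) →
                ∑ t ≡ t i + (n ∸ 1) * v
∑-constExcept {suc n} t i {v} t≡v = begin
  ∑ t                               ≡⟨ sum-remove {i = i} t ⟩
  t i + ∑[ j < n ] t (punchIn i j)  ≡⟨ cong (t i +_) (sum-cong-≗ (λ j → t≡v _ (punchInᵢ≢i i j))) ⟩
  t i + ∑[ j < n ] v                ≡⟨ cong (t i +_) (∑-const n v) ⟩
  t i + n * v                       ∎
  where open ≡-Reasoning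

∑-sift : ∀ {k} (g : Fin k → ℕ) c → ∑[ b < k ] (g b * 𝟙 (c ≟F b)) ≡ g c
∑-sift {k} g c = begin
  ∑[ b < k ] (g b * 𝟙 (c ≟F b))   ≡⟨ ∑-constExcept _ c off-c ⟩
  g c * 𝟙 (c ≟F c) + (k ∸ 1) * 0  ≡⟨ cong₂ _+_ at-c (*-zeroʳ (k ∸ 1)) ⟩
  g c + 0                          ≡⟨ +-identityʳ (g c) ⟩
  g c                              ∎
  where
  open ≡-Reasoning
  at-c : g c * 𝟙 (c ≟F c) ≡ g c
  at-c = trans (cong (g c *_) (𝟙-yes (c ≟F c) refl)) (*-identityʳ (g c))
  off-c : ∀ b → b ≢ c → g b * 𝟙 (c ≟F b) ≡ 0
  off-c b b≢c = trans (cong (g b *_) (𝟙-no (c ≟F b) (b≢c ∘ sym))) (*-zeroʳ (g b))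

sum-tabulate : ∀ {n} (g : Fin n → ℕ) → sum (tabulate g) ≡ ∑ g
sum-tabulate {zero}  g = refl
sum-tabulate {suc n} g = cong (g zero +_) (sum-tabulate (g ∘ suc))

length-filter-tabulate : ∀ {a p} {A : Set a} {P : Pred A p} (P? : Decidable P) {n} (g : Fin n → A) →
                         length (filter P? (tabulate g)) ≡ ∑[ i < n ] 𝟙 (P? (g i))
length-filter-tabulate P? {zero}  g = refl
length-filter-tabulate P? {suc n} g with P? (g zero)
... | yes _ = cong suc (length-filter-tabulate P? (g ∘ suc))
... | no  _ = length-filter-tabulate P? (g ∘ suc)

sum-map-filter : ∀ {a p} {A : Set a} {P : Pred A p} (P? : Decidable P) (h : A → ℕ) →
                 (∀ x → ¬ P x → h x ≡ 0) → ∀ xs → sum (map h (filter P? xs)) ≡ sum (map h xs)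
sum-map-filter P? h h≡0 []       = refl
sum-map-filter P? h h≡0 (x ∷ xs) with P? x
... | yes _ = cong (h x +_) (sum-map-filter P? h h≡0 xs)
... | no ¬p = trans (sum-map-filter P? h h≡0 xs) (cong (_+ sum (map h xs)) (sym (h≡0 x ¬p)))

length≤sum-map : ∀ {a} {A : Set a} (h : A → ℕ) {xs} → All (λ x → 1 ≤ h x) xs → length xs ≤ sum (map h xs)
length≤sum-map h []         = z≤n
length≤sum-map h (px ∷ pxs) = +-mono-≤ px (length≤sum-map h pxs)

sumSquares : List ℕ → ℕ
sumSquares xs = sum (map (λ x → x * x) xs)

2xy≤x²+y²-≤ : ∀ {x y} → x ≤ y → 2 * x * y ≤ x * x + y * y
2xy≤x²+y²-≤ {x} x≤y with t , refl ← m≤n⇒∃[o]m+o≡n x≤y =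
  subst (2 * x * (x + t) ≤_) (sym (expand x t)) (m≤m+n _ (t * t))
  where expand : ∀ x t → x * x + (x + t) * (x + t) ≡ 2 * x * (x + t) + t * t
        expand = solve-∀

2xy≤x²+y² : ∀ x y → 2 * x * y ≤ x * x + y * y
2xy≤x²+y² x y with ≤-total x y
... | inj₁ x≤y = 2xy≤x²+y²-≤ x≤y
... | inj₂ y≤x = subst₂ _≤_ (swap x y) (+-comm (y * y) (x * x)) (2xy≤x²+y²-≤ y≤x)
  where swap : ∀ x y → 2 * y * x ≡ 2 * x * y
        swap = solve-∀

2x*sum≤length*x²+sumSquares : ∀ x xs → 2 * x * sum xs ≤ length xs * (x * x) + sumSquares xs
2x*sum≤length*x²+sumSquares x []       = ≤-reflexive (*-zeroʳ (2 * x))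
2x*sum≤length*x²+sumSquares x (y ∷ ys) = begin
  2 * x * (y + sum ys)                       ≡⟨ *-distribˡ-+ (2 * x) y (sum ys) ⟩
  2 * x * y + 2 * x * sum ys                 ≤⟨ +-mono-≤ (2xy≤x²+y² x y) (2x*sum≤length*x²+sumSquares x ys) ⟩
  x * x + y * y + (length ys * (x * x) + Q)  ≡⟨ regroup (x * x) (y * y) (length ys * (x * x)) Q ⟩
  (x * x + length ys * (x * x)) + (y * y + Q) ∎
  where open ≤-Reasoning
        Q : ℕ
        Q = sumSquares ys
        regroup : ∀ a b c d → a + b + (c + d) ≡ (a + c) + (b + d)
        regroup = solve-∀

cauchy-schwarz : ∀ xs → sum xs * sum xs ≤ length xs * sumSquares xs
cauchy-schwarz []       = z≤n
cauchy-schwarz (x ∷ xs) = begin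
  (x + S) * (x + S)                      ≡⟨ expand x S ⟩
  x * x + 2 * x * S + S * S              ≤⟨ +-mono-≤ (+-monoʳ-≤ (x * x) (2x*sum≤length*x²+sumSquares x xs)) (cauchy-schwarz xs) ⟩
  x * x + (m * (x * x) + Q) + m * Q      ≡⟨ collect x m Q ⟩
  suc m * (x * x + Q)                    ∎
  where open ≤-Reasoning
        S : ℕ
        S = sum xs
        m : ℕ
        m = length xs
        Q : ℕ
        Q = sumSquares xs
        expand : ∀ x s → (x + s) * (x + s) ≡ x * x + 2 * x * s + s * s
        expand = solve-∀
        collect : ∀ x m q → x * x + (m * (x * x) + q) + m * q ≡ suc m * (x * x + q)
        collect = solve-∀

module _ {n k : ℕ} (f : Fin n → Fin k) where

  blockSize≡∑ : ∀ b → blockSize f b ≡ ∑[ x < n ] 𝟙 (f x ≟F b)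
  blockSize≡∑ b = length-filter-tabulate (λ x → f x ≟F b) id

  blockSize-empty : ∀ {b} → ¬ ∃ (λ x → f x ≡ b) → blockSize f b ≡ 0
  blockSize-empty {b} ∄x =
    cong length (filter-none (λ x → f x ≟F b) (All-tabulate⁺ λ x fx≡b → ∄x (x , fx≡b)))

  blockSize-nonempty : ∀ {b} → ∃ (λ x → f x ≡ b) → 1 ≤ blockSize f b
  blockSize-nonempty {b} (x , fx≡b) = filter-some (λ y → f y ≟F b) (Any.tabulate⁺ x fx≡b)

  ∑-fibres : ∀ (h : Fin k → ℕ) → ∑[ b < k ] (h b * blockSize f b) ≡ ∑[ x < n ] h (f x)
  ∑-fibres h = begin
    ∑[ b < k ] (h b * blockSize f b)              ≡⟨ sum-cong-≗ (λ b → cong (h b *_) (blockSize≡∑ b)) ⟩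
    ∑[ b < k ] (h b * ∑[ x < n ] 𝟙 (f x ≟F b))   ≡⟨ sum-cong-≗ (λ b → *-distribˡ-sum (h b) (λ x → 𝟙 (f x ≟F b))) ⟩
    ∑[ b < k ] ∑[ x < n ] (h b * 𝟙 (f x ≟F b))   ≡⟨ ∑-comm (λ b x → h b * 𝟙 (f x ≟F b)) ⟩
    ∑[ x < n ] ∑[ b < k ] (h b * 𝟙 (f x ≟F b))   ≡⟨ sum-cong-≗ (λ x → ∑-sift h (f x)) ⟩
    ∑[ x < n ] h (f x)                            ∎
    where open ≡-Reasoning

  sum-over-image : ∀ (h : Fin k → ℕ) → (∀ b → blockSize f b ≡ 0 → h b ≡ 0) → sum (map h (image f)) ≡ ∑ h
  sum-over-image h h≡0 = begin
    sum (map h (image f))        ≡⟨ sum-map-filter _ h (λ b ∄x → h≡0 b (blockSize-empty ∄x)) (allFin k) ⟩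
    sum (map h (tabulate id))    ≡⟨ cong sum (map-tabulate id h) ⟩
    sum (tabulate h)             ≡⟨ sum-tabulate h ⟩
    ∑ h                          ∎
    where open ≡-Reasoning

  tau≡order : tau f ≡ n
  tau≡order = begin
    tau f                               ≡⟨ sum-over-image (blockSize f) (λ _ → id) ⟩
    ∑[ b < k ] blockSize f b            ≡⟨ sum-cong-≗ (λ b → sym (*-identityˡ (blockSize f b))) ⟩
    ∑[ b < k ] (1 * blockSize f b)      ≡⟨ ∑-fibres (λ _ → 1) ⟩
    ∑[ x < n ] 1                        ≡⟨ ∑-const n 1 ⟩
    n * 1                               ≡⟨ *-identityʳ n ⟩
    n                                   ∎
    where open ≡-Reasoning

  imageSize≤tau : imageSize f ≤ tau f
  imageSize≤tau = length≤sum-map (blockSize f) (All.map blockSize-nonempty (all-filter _ (allFin k)))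

  tau²≤imageSize*∑blockSize² : tau f * tau f ≤ imageSize f * ∑[ b < k ] (blockSize f b * blockSize f b)
  tau²≤imageSize*∑blockSize² = begin
    tau f * tau f                                        ≤⟨ cauchy-schwarz (map (blockSize f) (image f)) ⟩
    length ws * sumSquares ws                            ≡⟨ cong₂ _*_ (length-map (blockSize f) (image f)) squares ⟩
    imageSize f * ∑[ b < k ] (blockSize f b * blockSize f b) ∎
    where open ≤-Reasoning
          ws : List ℕ
          ws = map (blockSize f) (image f)
          squares : sumSquares ws ≡ ∑[ b < k ] (blockSize f b * blockSize f b)
          squares = trans (cong sum (sym (map-∘ (image f))))
                          (sum-over-image _ (λ b w≡0 → cong (λ w → w * w) w≡0))

∃≢ : ∀ {n} → 2 ≤ n → (x : Fin n) → ∃ λ y → y ≢ x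
∃≢ (s≤s (s≤s _)) zero    = suc zero , λ ()
∃≢ (s≤s (s≤s _)) (suc _) = zero , λ ()

module _ {n k : ℕ} (G : FinAbGroup n) (f : Fin n → Fin k) where
  open FinAbGroup G
  open IsAbelianGroup isAbelianGroup using (assoc; identityˡ; identityʳ; inverseˡ; inverseʳ)

  translation : Fin n → Permutation n n
  translation x = permutation (x ⊕_) ((⊝ x) ⊕_) (cancel x (⊝ x) (inverseʳ x)) (cancel (⊝ x) x (inverseˡ x))
    where cancel : ∀ x y → x ⊕ y ≡ 𝟘 → ∀ z → x ⊕ (y ⊕ z) ≡ z
          cancel x y x⊕y≡𝟘 z = trans (sym (assoc x y z)) (trans (cong (_⊕ z) x⊕y≡𝟘) (identityˡ z))

  zeroDiffCount≡∑ : ∀ α → zeroDiffCount G f α ≡ ∑[ x < n ] 𝟙 (f (x ⊕ α) ≟F f x)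
  zeroDiffCount≡∑ α = length-filter-tabulate (λ x → f (x ⊕ α) ≟F f x) id

  zeroDiffCount-𝟘 : zeroDiffCount G f 𝟘 ≡ n
  zeroDiffCount-𝟘 = begin
    zeroDiffCount G f 𝟘                     ≡⟨ zeroDiffCount≡∑ 𝟘 ⟩
    ∑[ x < n ] 𝟙 (f (x ⊕ 𝟘) ≟F f x)         ≡⟨ sum-cong-≗ (λ x → 𝟙-yes (f (x ⊕ 𝟘) ≟F f x) (cong f (identityʳ x))) ⟩
    ∑[ x < n ] 1                            ≡⟨ ∑-const n 1 ⟩
    n * 1                                   ≡⟨ *-identityʳ n ⟩
    n                                       ∎
    where open ≡-Reasoning

  zeroDiffCount≤order : ∀ α → zeroDiffCount G f α ≤ n
  zeroDiffCount≤order α =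
    ≤-trans (length-filter (λ x → f (x ⊕ α) ≟F f x) (allFin n)) (≤-reflexive (length-tabulate id))

  ∑blockSize²≡∑zeroDiffCount : ∑[ b < k ] (blockSize f b * blockSize f b) ≡ ∑[ α < n ] zeroDiffCount G f α
  ∑blockSize²≡∑zeroDiffCount = begin
    ∑[ b < k ] (blockSize f b * blockSize f b)      ≡⟨ ∑-fibres f (blockSize f) ⟩
    ∑[ x < n ] blockSize f (f x)                    ≡⟨ sum-cong-≗ (λ x → blockSize≡∑ f (f x)) ⟩
    ∑[ x < n ] ∑[ y < n ] 𝟙 (f y ≟F f x)            ≡⟨ sum-cong-≗ (λ x → ∑-permute (λ y → 𝟙 (f y ≟F f x)) (translation x)) ⟩
    ∑[ x < n ] ∑[ α < n ] 𝟙 (f (x ⊕ α) ≟F f x)      ≡⟨ ∑-comm (λ x α → 𝟙 (f (x ⊕ α) ≟F f x)) ⟩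
    ∑[ α < n ] ∑[ x < n ] 𝟙 (f (x ⊕ α) ≟F f x)      ≡⟨ sum-cong-≗ (λ α → sym (zeroDiffCount≡∑ α)) ⟩
    ∑[ α < n ] zeroDiffCount G f α                  ∎
    where open ≡-Reasoning

  module _ {lam : ℕ} (balanced : ∀ α → ¬ α ≡ 𝟘 → zeroDiffCount G f α ≡ lam) where

    ∑blockSize²≡n+[n∸1]*lam : ∑[ b < k ] (blockSize f b * blockSize f b) ≡ n + (n ∸ 1) * lam
    ∑blockSize²≡n+[n∸1]*lam = begin
      ∑[ b < k ] (blockSize f b * blockSize f b)   ≡⟨ ∑blockSize²≡∑zeroDiffCount ⟩
      ∑[ α < n ] zeroDiffCount G f α               ≡⟨ ∑-constExcept _ 𝟘 balanced ⟩
      zeroDiffCount G f 𝟘 + (n ∸ 1) * lam          ≡⟨ cong (_+ (n ∸ 1) * lam) zeroDiffCount-𝟘 ⟩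
      n + (n ∸ 1) * lam                            ∎
      where open ≡-Reasoning

    lam≤order : 2 ≤ n → lam ≤ n
    lam≤order 2≤n with α , α≢𝟘 ← ∃≢ 2≤n 𝟘 = subst (_≤ n) (balanced α α≢𝟘) (zeroDiffCount≤order α)

≤/⇔ : ∀ q x d .{{_ : NonZero d}} → q ≤ x / d ⇔ q * d ≤ x
≤/⇔ q x d = mk⇔ (λ q≤x/d → ≤-trans (*-monoˡ-≤ d q≤x/d) (m/n*n≤m x d))
                (λ qd≤x → subst (_≤ x / d) (m*n/n≡m q d) (/-monoˡ-≤ d qd≤x))

<ceilDiv⇔ : ∀ y x c → y < ceilDiv x (suc c) ⇔ y * suc c < x
<ceilDiv⇔ y x c = begin
  y < ceilDiv x (suc c)          ≈⟨ ≤/⇔ (suc y) (x + c) (suc c) ⟩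
  suc c + y * suc c ≤ x + c      ≡⟨ cong₂ _≤_ (sym (+-suc c (y * suc c))) (+-comm x c) ⟩
  c + suc (y * suc c) ≤ c + x    ≈⟨ mk⇔ (+-cancelˡ-≤ c _ _) (+-monoʳ-≤ c) ⟩
  y * suc c < x                  ∎
  where open import Relation.Binary.Reasoning.Setoid (⇔-setoid 0ℓ)

ceilDiv≤ : ∀ {x s c} → x ≤ s * suc c → ceilDiv x (suc c) ≤ s
ceilDiv≤ {x} {s} {c} x≤ = ≮⇒≥ (λ s<⌈x⌉ → <⇒≱ (Equivalence.to (<ceilDiv⇔ s x c) s<⌈x⌉) x≤)

IsSQUARE-suc²⇔ : ∀ {x a} → x ≤ suc a * suc a → IsSQUARE x (suc a * suc a) ⇔ a * a < x
IsSQUARE-suc²⇔ {x} {a} x≤ = mk⇔ above-a² (λ a²<x → (suc a , refl) , x≤ , least a²<x)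
  where
  above-a² : IsSQUARE x (suc a * suc a) → a * a < x
  above-a² (_ , _ , least) = ≰⇒> (λ x≤a² → <⇒≱ (*-mono-< (n<1+n a) (n<1+n a)) (least a x≤a²))
  least : a * a < x → ∀ r → x ≤ r * r → suc a * suc a ≤ r * r
  least a²<x r x≤r² = *-mono-≤ a<r a<r
    where a<r : a < r
          a<r = ≰⇒> (λ r≤a → <⇒≱ (<-≤-trans a²<x x≤r²) (*-mono-≤ r≤a r≤a))

dssBound : (n q ρ : ℕ) → ℕ
dssBound n q ρ = ρ * (n ∸ 1) + ceilDiv (ρ * (n ∸ 1)) (q ∸ 1)

dssBound≤square : ∀ {a c ρ S} → ρ * a + S ≡ suc a * suc a → suc a * suc a ≤ suc (suc c) * S →
                  dssBound (suc a) (suc (suc c)) ρ ≤ suc a * suc a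
dssBound≤square {a} {c} {ρ} {S} X+S≡n² n²≤mS =
  ≤-trans (+-monoʳ-≤ X (ceilDiv≤ X≤S*[m∸1])) (≤-reflexive X+S≡n²)
  where
  X : ℕ
  X = ρ * a
  split : ∀ c S → suc (suc c) * S ≡ S * suc c + S
  split = solve-∀
  X≤S*[m∸1] : X ≤ S * suc c
  X≤S*[m∸1] = +-cancelʳ-≤ S X (S * suc c) (begin
    X + S                    ≡⟨ X+S≡n² ⟩
    suc a * suc a            ≤⟨ n²≤mS ⟩
    suc (suc c) * S          ≡⟨ split c S ⟩
    S * suc c + S            ∎)
    where open ≤-Reasoning

square<dssBound⇔ : ∀ a c ρ lam .{{_ : NonZero a}} → ρ + lam ≡ suc a →
                   a * a < dssBound (suc a) (suc (suc c)) ρ ⇔ suc (suc c) * lam + 2 ≤ suc a + suc (suc c)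
square<dssBound⇔ a c ρ zero ρ+0≡n with refl ← trans (sym (+-identityʳ ρ)) ρ+0≡n = mk⇔
  (λ _ → subst (λ t → t + 2 ≤ suc a + suc (suc c)) (sym (*-zeroʳ (suc (suc c))))
               (≤-trans (s≤s (s≤s z≤n)) (m≤n+m (suc (suc c)) (suc a))))
  (λ _ → <-≤-trans (m<n+m (a * a) (>-nonZero⁻¹ a)) (m≤m+n (suc a * a) _))
square<dssBound⇔ a c ρ (suc l) ρ+1+l≡n = begin
  a * a < X + ⌈X⌉                               ≡⟨ cong (_< X + ⌈X⌉) a²≡X+la ⟩
  X + l * a < X + ⌈X⌉                           ≈⟨ mk⇔ (+-cancelˡ-< X _ _) (+-monoʳ-< X) ⟩
  l * a < ⌈X⌉                                   ≈⟨ <ceilDiv⇔ (l * a) X c ⟩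
  l * a * suc c < ρ * a                         ≡⟨ cong (_< ρ * a) (reorder l a c) ⟩
  l * suc c * a < ρ * a                         ≈⟨ mk⇔ (*-cancelʳ-< a _ _) (*-monoˡ-< a) ⟩
  l * suc c < ρ                                 ≈⟨ mk⇔ (+-monoˡ-< l) (+-cancelʳ-< l _ _) ⟩
  l * suc c + l < ρ + l                         ≡⟨ cong (l * suc c + l <_) ρ+l≡a ⟩
  l * suc c + l < a                             ≈⟨ mk⇔ (+-monoˡ-≤ (3 + c)) (+-cancelʳ-≤ (3 + c) _ _) ⟩
  suc (l * suc c + l) + (3 + c) ≤ a + (3 + c)   ≡⟨ cong₂ _≤_ (lhs l c) (rhs a c) ⟩
  suc (suc c) * suc l + 2 ≤ suc a + suc (suc c) ∎
  where
  open import Relation.Binary.Reasoning.Setoid (⇔-setoid 0ℓ)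
  X : ℕ
  X = ρ * a
  ⌈X⌉ : ℕ
  ⌈X⌉ = ceilDiv X (suc c)
  ρ+l≡a : ρ + l ≡ a
  ρ+l≡a = suc-injective (trans (sym (+-suc ρ l)) ρ+1+l≡n)
  a²≡X+la : a * a ≡ X + l * a
  a²≡X+la = trans (cong (_* a) (sym ρ+l≡a)) (*-distribʳ-+ a ρ l)
  reorder : ∀ l a c → l * a * suc c ≡ l * suc c * a
  reorder = solve-∀
  lhs : ∀ l c → suc (l * suc c + l) + (3 + c) ≡ suc (suc c) * suc l + 2
  lhs = solve-∀
  rhs : ∀ a c → a + (3 + c) ≡ suc a + suc (suc c)
  rhs = solve-∀

optimal⇔ : ∀ {n m lam S} → 2 ≤ m → m ≤ n → lam ≤ n → S ≡ n + (n ∸ 1) * lam → n * n ≤ m * S →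
           OptimalDSS n m (n ∸ lam) n ⇔ (m * lam + 2 ≤ n + m)
optimal⇔ {suc a@(suc _)} {suc (suc c)} {lam} {S} (s≤s (s≤s z≤n)) (s≤s (s≤s _)) lam≤n S≡ n²≤mS =
  ⇔-trans (IsSQUARE-suc²⇔ (dssBound≤square {a} {c} {ρ} {S} X+S≡n² n²≤mS)) (square<dssBound⇔ a c ρ lam ρ+lam≡n)
  where
  ρ : ℕ
  ρ = suc a ∸ lam
  ρ+lam≡n : ρ + lam ≡ suc a
  ρ+lam≡n = m∸n+n≡m lam≤n
  regroup : ∀ ρ a l → ρ * a + (suc a + a * l) ≡ suc a + a * (ρ + l)
  regroup = solve-∀
  X+S≡n² : ρ * a + S ≡ suc a * suc a
  X+S≡n² = begin
    ρ * a + S                    ≡⟨ cong (ρ * a +_) S≡ ⟩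
    ρ * a + (suc a + a * lam)    ≡⟨ regroup ρ a lam ⟩
    suc a + a * (ρ + lam)        ≡⟨ cong (λ t → suc a + a * t) ρ+lam≡n ⟩
    suc a * suc a                ∎
    where open ≡-Reasoning

theorem6 : (n k : ℕ) (A : FinAbGroup n) (B : FinAbGroup k) (f : Fin n → Fin k)
    (m lam : ℕ) → 2 ≤ m → IsZDB A f m lam →
    OptimalDSS n (imageSize f) (n ∸ lam) (tau f) ⇔ (m * lam + 2 ≤ n + m)
theorem6 n k A B f m lam 2≤m (m≡imageSize , balanced) =
  subst₂ (λ q τ → OptimalDSS n q (n ∸ lam) τ ⇔ (m * lam + 2 ≤ n + m)) m≡imageSize (sym (tau≡order f))
    (optimal⇔ 2≤m m≤n (lam≤order A f balanced (≤-trans 2≤m m≤n))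
              (∑blockSize²≡n+[n∸1]*lam A f balanced) n²≤m*∑w²)
  where
  m≤n : m ≤ n
  m≤n = subst₂ _≤_ (sym m≡imageSize) (tau≡order f) (imageSize≤tau f)
  ∑w² : ℕ
  ∑w² = ∑[ b < k ] (blockSize f b * blockSize f b)
  n²≤m*∑w² : n * n ≤ m * ∑w²
  n²≤m*∑w² = subst₂ (λ τ q → τ * τ ≤ q * ∑w²) (tau≡order f) (sym m≡imageSize) (tau²≤imageSize*∑blockSize² f)
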